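{- For every W-logic $\mathsf{WL}$ and every formula $A$ of $\mathcal L$: if $\mathsf{WL}\vdash A$, then $\mathcal M\models A$ for every constructive neighbourhood model $\mathcal M$ for $\mathsf{WL}$.
   Context: The language $\mathcal{L}$ consists of the formulas built from a countable set $\mathrm{Atm}$ of propositional variables by $A ::= p \mid \bot \mid A\land A \mid A\lor A \mid A\to A \mid \Box A \mid \Diamond A$; $\top := \bot\to\bot$ and $\neg A := A\to\bot$. Axiom schemes and rules (for all formulas $A,B$): (Mon$_\Box$) from $A\to B$ infer $\Box A\to\Box B$; (Mon$_\Diamond$) from $A\to B$ infer $\Diamond A\to\Diamond B$; (C$_\Box$) $\Box A\land\Box B\to\Box(A\land B)$; (K$_\Diamond$) $\Box(A\to B)\to(\Diamond A\to\Diamond B)$; (N$_\Box$) $\Box\top$; (T$_\Box$) $\Box A\to A$; (T$_\Diamond$) $A\to\Diamond A$; (D) $\Box A\to\Diamond A$; (P$_\Diamond$) $\Diamond\top$; (Dual$_\land$) $\neg(\Box A\land\Diamond\neg A)$. The W-logics are obtained by adding to an axiomatisation of intuitionistic propositional logic (all $\mathcal L$-instances of its axiom schemes, with modus ponens) the following: $\mathsf{WM}$ := Dual$_\land$ + Mon$_\Box$ + Mon$_\Diamond$; $\mathsf{WMN}$ := $\mathsf{WM}$ + N$_\Box$; $\mathsf{WMC}$ := $\mathsf{WM}$ + C$_\Box$ + K$_\Diamond$; $\mathsf{WK}$ := $\mathsf{WMC}$ + N$_\Box$; $\mathsf{WMP}$ := $\mathsf{WM}$ + P$_\Diamond$; $\mathsf{WMNP}$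 := $\mathsf{WMN}$ + P$_\Diamond$; $\mathsf{WMD}$ := $\mathsf{WM}$ + D + P$_\Diamond$; $\mathsf{WMND}$ := $\mathsf{WMN}$ + D; $\mathsf{WMCD}$ := $\mathsf{WMC}$ + D + P$_\Diamond$; $\mathsf{WKD}$ := $\mathsf{WK}$ + D; $\mathsf{WMT}$ := $\mathsf{WM}$ + T$_\Box$ + T$_\Diamond$; $\mathsf{WMNT}$ := $\mathsf{WMN}$ + T$_\Box$ + T$_\Diamond$; $\mathsf{WMCT}$ := $\mathsf{WMC}$ + T$_\Box$ + T$_\Diamond$; $\mathsf{WKT}$ := $\mathsf{WK}$ + T$_\Box$ + T$_\Diamond$. $\mathsf{WL}\vdash A$ means $A$ is the last element of a finite sequence each element of which is an axiom instance of $\mathsf{WL}$ or follows from earlier elements by modus ponens or a rule of $\mathsf{WL}$. A constructive neighbourhood model (CNM) is $\mathcal M=\langle W,\le,N,V\rangle$ with $W\neq\emptyset$, $\le$ a preorder on $W$, $N:W\to\mathcal P(\mathcal P(W))$, and $V:\mathrm{Atm}\to\mathcal P(W)$ hereditary (if $w\in V(p)$ and $w\le v$ then $v\in V(p)$). Forcing: $w\Vdash p$ iff $w\in V(p)$; $w\not\Vdash\bot$; $\land,\lor$ pointwise; $w\Vdash B\to C$ iff for all $v\ge w$, $v\Vdash B$ implies $v\Vdash C$; $w\Vdash\Box B$ iff for all $v\ge w$ there is $\alpha\in N(v)$ with $u\Vdash B$ for all $u\in\alpha$; $w\Vdash\Diamond B$ iff for all $v\ge w$ and all $\alpha\in N(v)$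 there is $u\in\alpha$ with $u\Vdash B$. Conditions (for all $w$): (C) if $\alpha,\beta\in N(w)$ then $\alpha\cap\beta\in N(w)$; (N) $N(w)\neq\emptyset$; (D) if $\alpha,\beta\in N(w)$ then $\alpha\cap\beta\neq\emptyset$; (P) $\emptyset\notin N(w)$; (T) if $\alpha\in N(w)$ then $w\in\alpha$. $\mathcal M$ is a model for $\mathsf{WL}$ if it satisfies (C) whenever C$_\Box$ is an axiom of $\mathsf{WL}$, (N) whenever N$_\Box$ is, (T) whenever T$_\Box$ is, (D) whenever D is, and (P) whenever P$_\Diamond$ is. $\mathcal M\models A$ means $w\Vdash A$ for all $w\in W$. -}

module Defs where

open import Data.Nat using (ℕ)
open import Data.Empty using (⊥)
open import Data.Unit using (⊤)
open import Data.Bool using (Bool; true; false; T)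
open import Data.Product using (Σ; _×_; ∃)
open import Data.Sum using (_⊎_)
open import Relation.Nullary using (¬_)
open import Level using (Lift)

infixr 6 _∧′_
infixr 5 _∨′_
infixr 4 _⇒_

data Fm : Set where
  var  : ℕ → Fm
  ⊥′   : Fm
  _∧′_ : Fm → Fm → Fm
  _∨′_ : Fm → Fm → Fm
  _⇒_  : Fm → Fm → Fm
  □    : Fm → Fm
  ◇    : Fm → Fm

⊤′ : Fm
⊤′ = ⊥′ ⇒ ⊥′

¬′ : Fm → Fm
¬′ A = A ⇒ ⊥′

data WL : Set where
  WM WMN WMC WK WMP WMNP WMD WMND WMCD WKD WMT WMNT WMCT WKT : WL

hasC hasN hasD hasP hasT : WL → Bool

hasC WMC  = true
hasC WK   = true
hasC WMCD = true
hasC WKD  = true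
hasC WMCT = true
hasC WKT  = true
hasC _    = false

hasN WMN  = true
hasN WK   = true
hasN WMNP = true
hasN WMND = true
hasN WKD  = true
hasN WMNT = true
hasN WKT  = true
hasN _    = false

hasD WMD  = true
hasD WMND = true
hasD WMCD = true
hasD WKD  = true
hasD _    = false

hasP WMP  = true
hasP WMNP = true
hasP WMD  = true
hasP WMCD = true
hasP _    = false

hasT WMT  = true
hasT WMNT = true
hasT WMCT = true
hasT WKT  = true
hasT _    = false

data _⊢_ (L : WL) : Fm → Set where
  ax-K   : ∀ {A B}   → L ⊢ (A ⇒ B ⇒ A)
  ax-S   : ∀ {A B C} → L ⊢ ((A ⇒ B ⇒ C) ⇒ (A ⇒ B) ⇒ A ⇒ C)
  ax-∧E₁ : ∀ {A B}   → L ⊢ (A ∧′ B ⇒ A)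
  ax-∧E₂ : ∀ {A B}   → L ⊢ (A ∧′ B ⇒ B)
  ax-∧I  : ∀ {A B}   → L ⊢ (A ⇒ B ⇒ A ∧′ B)
  ax-∨I₁ : ∀ {A B}   → L ⊢ (A ⇒ A ∨′ B)
  ax-∨I₂ : ∀ {A B}   → L ⊢ (B ⇒ A ∨′ B)
  ax-∨E  : ∀ {A B C} → L ⊢ ((A ⇒ C) ⇒ (B ⇒ C) ⇒ A ∨′ B ⇒ C)
  ax-⊥E  : ∀ {A}     → L ⊢ (⊥′ ⇒ A)
  mp     : ∀ {A B}   → L ⊢ (A ⇒ B) → L ⊢ A → L ⊢ B
  dual∧  : ∀ {A}     → L ⊢ ¬′ (□ A ∧′ ◇ (¬′ A))
  mon□   : ∀ {A B}   → L ⊢ (A ⇒ B) → L ⊢ (□ A ⇒ □ B)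
  mon◇   : ∀ {A B}   → L ⊢ (A ⇒ B) → L ⊢ (◇ A ⇒ ◇ B)
  C□     : ∀ {A B}   → T (hasC L) → L ⊢ (□ A ∧′ □ B ⇒ □ (A ∧′ B))
  K◇     : ∀ {A B}   → T (hasC L) → L ⊢ (□ (A ⇒ B) ⇒ ◇ A ⇒ ◇ B)
  N□     :             T (hasN L) → L ⊢ □ ⊤′
  T□     : ∀ {A}     → T (hasT L) → L ⊢ (□ A ⇒ A)
  T◇     : ∀ {A}     → T (hasT L) → L ⊢ (A ⇒ ◇ A)
  axD    : ∀ {A}     → T (hasD L) → L ⊢ (□ A ⇒ ◇ A)
  P◇     :             T (hasP L) → L ⊢ ◇ ⊤′

record CNM : Set₁ where
  field
    W       : Set
    inhab   : W
    _≤_     : W → W → Set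
    ≤-refl  : ∀ {w} → w ≤ w
    ≤-trans : ∀ {u v w} → u ≤ v → v ≤ w → u ≤ w
    N       : W → (W → Set) → Set
    V       : ℕ → W → Set
    V-here  : ∀ {p w v} → V p w → w ≤ v → V p v

module _ (M : CNM) where
  open CNM M

  -- forcing (lives in Set₁ since □ quantifies over subsets of W)
  _⊩_ : W → Fm → Set₁
  w ⊩ var p   = Lift _ (V p w)
  w ⊩ ⊥′      = Lift _ ⊥
  w ⊩ (A ∧′ B) = (w ⊩ A) × (w ⊩ B)
  w ⊩ (A ∨′ B) = (w ⊩ A) ⊎ (w ⊩ B)
  w ⊩ (A ⇒ B) = ∀ v → w ≤ v → v ⊩ A → v ⊩ B
  w ⊩ □ A     = ∀ v → w ≤ v → Σ (W → Set) λ α → N v α × (∀ u → α u → u ⊩ A)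
  w ⊩ ◇ A     = ∀ v → w ≤ v → ∀ α → N v α → Σ W λ u → α u × (u ⊩ A)

  Valid : Fm → Set₁
  Valid A = ∀ w → w ⊩ A

  CondC CondN CondD CondP CondT : Set₁
  CondC = ∀ w α β → N w α → N w β → N w (λ u → α u × β u)
  CondN = ∀ w → Σ (W → Set) λ α → N w α
  CondD = ∀ w α β → N w α → N w β → Σ W λ u → α u × β u
  CondP = ∀ w α → N w α → Σ W λ u → α u
  CondT = ∀ w α → N w α → α w

_⇛_ : Bool → Set₁ → Set₁
b ⇛ X = T b → X

ModelFor : WL → CNM → Set₁
ModelFor L M = (hasC L ⇛ CondC M) × (hasN L ⇛ CondN M) × (hasD L ⇛ CondD M)
             × (hasP L ⇛ CondP M) × (hasT L ⇛ CondT M)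

-- Forcing is persistent along ≤ (the clauses for →, □
-- and ◇ quantify over all successors), which validates the intuitionistic axioms;
-- each optional modal axiom is validated by exactly the frame condition paired
-- with it, and validity is closed under modus ponens and the monotonicity rules.
module Submission where

open import Defs
open import Data.Product using (_,_; proj₁; proj₂)
open import Data.Sum using (inj₁; inj₂)
open import Level using (lift)

module Soundness (M : CNM) where
  open CNM M

  infix 2 _⊩ᴹ_
  _⊩ᴹ_ : W → Fm → Set₁
  _⊩ᴹ_ = _⊩_ M

  ⊩-mono : ∀ A {w v} → w ≤ v → w ⊩ᴹ A → v ⊩ᴹ A
  ⊩-mono (var p)  w≤v (lift x)  = lift (V-here x w≤v)
  ⊩-mono ⊥′       w≤v (lift ())
  ⊩-mono (A ∧′ B) w≤v (a , b)   = ⊩-mono A w≤v a , ⊩-mono B w≤v b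
  ⊩-mono (A ∨′ B) w≤v (inj₁ a)  = inj₁ (⊩-mono A w≤v a)
  ⊩-mono (A ∨′ B) w≤v (inj₂ b)  = inj₂ (⊩-mono B w≤v b)
  ⊩-mono (A ⇒ B)  w≤v f         = λ u v≤u → f u (≤-trans w≤v v≤u)
  ⊩-mono (□ A)    w≤v f         = λ u v≤u → f u (≤-trans w≤v v≤u)
  ⊩-mono (◇ A)    w≤v f         = λ u v≤u → f u (≤-trans w≤v v≤u)

  ⊩-⊤ : ∀ {w} → w ⊩ᴹ ⊤′
  ⊩-⊤ _ _ x = x

  valid-⇒ : ∀ {A B} → Valid M (A ⇒ B) → ∀ w → w ⊩ᴹ A → w ⊩ᴹ B
  valid-⇒ ⊨A⇒B w = ⊨A⇒B w w ≤-refl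

  valid-mp : ∀ {A B} → Valid M (A ⇒ B) → Valid M A → Valid M B
  valid-mp ⊨A⇒B ⊨A w = valid-⇒ ⊨A⇒B w (⊨A w)

  valid-K : ∀ {A B} → Valid M (A ⇒ B ⇒ A)
  valid-K {A} _ _ _ a u v≤u _ = ⊩-mono A v≤u a

  valid-S : ∀ {A B C} → Valid M ((A ⇒ B ⇒ C) ⇒ (A ⇒ B) ⇒ A ⇒ C)
  valid-S _ _ _ f u v≤u g x u≤x a = f x (≤-trans v≤u u≤x) a x ≤-refl (g x u≤x a)

  valid-∧E₁ : ∀ {A B} → Valid M (A ∧′ B ⇒ A)
  valid-∧E₁ _ _ _ = proj₁

  valid-∧E₂ : ∀ {A B} → Valid M (A ∧′ B ⇒ B)
  valid-∧E₂ _ _ _ = proj₂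

  valid-∧I : ∀ {A B} → Valid M (A ⇒ B ⇒ A ∧′ B)
  valid-∧I {A} _ _ _ a u v≤u b = ⊩-mono A v≤u a , b

  valid-∨I₁ : ∀ {A B} → Valid M (A ⇒ A ∨′ B)
  valid-∨I₁ _ _ _ = inj₁

  valid-∨I₂ : ∀ {A B} → Valid M (B ⇒ A ∨′ B)
  valid-∨I₂ _ _ _ = inj₂

  valid-∨E : ∀ {A B C} → Valid M ((A ⇒ C) ⇒ (B ⇒ C) ⇒ A ∨′ B ⇒ C)
  valid-∨E _ _ _ f u v≤u g x u≤x (inj₁ a) = f x (≤-trans v≤u u≤x) a
  valid-∨E _ _ _ f u v≤u g x u≤x (inj₂ b) = g x u≤x b

  valid-⊥E : ∀ {A} → Valid M (⊥′ ⇒ A)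
  valid-⊥E _ _ _ (lift ())

  valid-dual∧ : ∀ {A} → Valid M (¬′ (□ A ∧′ ◇ (¬′ A)))
  valid-dual∧ _ v _ (□A , ◇¬A) =
    let α , Nα , α⊩A = □A v ≤-refl
        u , αu , u⊩¬A = ◇¬A v ≤-refl α Nα
    in u⊩¬A u ≤-refl (α⊩A u αu)

  valid-mon□ : ∀ {A B} → Valid M (A ⇒ B) → Valid M (□ A ⇒ □ B)
  valid-mon□ ⊨A⇒B _ _ _ □A u v≤u =
    let α , Nα , α⊩A = □A u v≤u
    in α , Nα , λ x αx → valid-⇒ ⊨A⇒B x (α⊩A x αx)

  valid-mon◇ : ∀ {A B} → Valid M (A ⇒ B) → Valid M (◇ A ⇒ ◇ B)
  valid-mon◇ ⊨A⇒B _ _ _ ◇A u v≤u α Nα =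
    let x , αx , x⊩A = ◇A u v≤u α Nα
    in x , αx , valid-⇒ ⊨A⇒B x x⊩A

  valid-C□ : CondC M → ∀ {A B} → Valid M (□ A ∧′ □ B ⇒ □ (A ∧′ B))
  valid-C□ closed _ _ _ (□A , □B) u v≤u =
    let α , Nα , α⊩A = □A u v≤u
        β , Nβ , β⊩B = □B u v≤u
    in _ , closed u α β Nα Nβ , λ x αβx → α⊩A x (proj₁ αβx) , β⊩B x (proj₂ αβx)

  -- A ◇-witness is sought in α ∩ β, where β is the □-neighbourhood of A ⇒ B.
  valid-K◇ : CondC M → ∀ {A B} → Valid M (□ (A ⇒ B) ⇒ ◇ A ⇒ ◇ B)
  valid-K◇ closed _ _ _ □A⇒B u v≤u ◇A x u≤x α Nα =
    let β , Nβ , β⊩A⇒B = □A⇒B x (≤-trans v≤u u≤x)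
        y , (αy , βy) , y⊩A = ◇A x u≤x _ (closed x α β Nα Nβ)
    in y , αy , β⊩A⇒B y βy y ≤-refl y⊩A

  valid-N□ : CondN M → Valid M (□ ⊤′)
  valid-N□ nonempty _ v _ = let α , Nα = nonempty v in α , Nα , λ _ _ → ⊩-⊤

  valid-T□ : CondT M → ∀ {A} → Valid M (□ A ⇒ A)
  valid-T□ reflexive _ v _ □A = let α , Nα , α⊩A = □A v ≤-refl in α⊩A v (reflexive v α Nα)

  valid-T◇ : CondT M → ∀ {A} → Valid M (A ⇒ ◇ A)
  valid-T◇ reflexive {A} _ _ _ a u v≤u α Nα = u , reflexive u α Nα , ⊩-mono A v≤u a

  valid-D : CondD M → ∀ {A} → Valid M (□ A ⇒ ◇ A)
  valid-D intersecting _ _ _ □A u v≤u α Nα =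
    let β , Nβ , β⊩A = □A u v≤u
        y , αy , βy = intersecting u α β Nα Nβ
    in y , αy , β⊩A y βy

  valid-P◇ : CondP M → Valid M (◇ ⊤′)
  valid-P◇ proper _ _ _ α Nα = let y , αy = proper _ α Nα in y , αy , ⊩-⊤

  soundness : ∀ {L A} → ModelFor L M → L ⊢ A → Valid M A
  soundness _ ax-K   = valid-K
  soundness _ ax-S   = valid-S
  soundness _ ax-∧E₁ = valid-∧E₁
  soundness _ ax-∧E₂ = valid-∧E₂
  soundness _ ax-∧I  = valid-∧I
  soundness _ ax-∨I₁ = valid-∨I₁
  soundness _ ax-∨I₂ = valid-∨I₂
  soundness _ ax-∨E  = valid-∨E
  soundness _ ax-⊥E  = valid-⊥E
  soundness model (mp d e) = valid-mp (soundness model d) (soundness model e)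
  soundness _ dual∧  = valid-dual∧
  soundness model (mon□ d) = valid-mon□ (soundness model d)
  soundness model (mon◇ d) = valid-mon◇ (soundness model d)
  soundness (c , _ , _ , _ , _) (C□ h)  = valid-C□ (c h)
  soundness (c , _ , _ , _ , _) (K◇ h)  = valid-K◇ (c h)
  soundness (_ , n , _ , _ , _) (N□ h)  = valid-N□ (n h)
  soundness (_ , _ , _ , _ , t) (T□ h)  = valid-T□ (t h)
  soundness (_ , _ , _ , _ , t) (T◇ h)  = valid-T◇ (t h)
  soundness (_ , _ , d , _ , _) (axD h) = valid-D (d h)
  soundness (_ , _ , _ , p , _) (P◇ h)  = valid-P◇ (p h)

theorem4p3 : (L : WL) (A : Fm) → L ⊢ A → (M : CNM) → ModelFor L M → Valid M A
theorem4p3 L A d M model = Soundness.soundness M model d
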